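{- Let $D=(V,A)$ be a strongly connected digraph of order $n\ge 4$. Then $\xi^C(D)\ge 3(n-1)$, and equality holds if and only if $D$ is the complete biorientation $\overleftrightarrow{S}_n$ of the star graph $S_n$ on $n$ vertices.
   Context: Digraphs have no loops and no parallel arcs. The complete biorientation of an undirected graph replaces each edge $\{x,y\}$ by both arcs $(x,y)$ and $(y,x)$; $S_n$ is the star $K_{1,n-1}$. For a strongly connected digraph $D$, $\vec d(u,v)$ is the length of a shortest directed $u$–$v$ path, $md(u,v)=\max\{\vec d(u,v),\vec d(v,u)\}$, $mecc(u)=\max\{md(u,v):v\in V\}$, and $\xi^C(D)=\frac12\sum_{u\in V}(d^+_u+d^-_u)\,mecc(u)$, where $d^+_u,d^-_u$ are the out-degree and in-degree. -}

module Defs where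

open import Data.Nat using (ℕ; zero; suc; _+_; _*_; _⊔_)
open import Data.Bool using (Bool; true; false; _∨_; _∧_; if_then_else_)
open import Data.Fin using (Fin; _≟_)
open import Data.List using (List; map; foldr)
open import Data.Nat.ListAction using (sum)
open import Data.Bool.ListAction using (any)
open import Data.List using () renaming (allFin to allFinL)
open import Data.Product using (Σ; _×_; ∃)
open import Data.Sum using (_⊎_)
open import Relation.Nullary using (¬_; does)
open import Relation.Binary.PropositionalEquality using (_≡_)
open import Function.Bundles using (_⇔_)

-- A digraph on vertex set Fin n: arc relation, no loops (no parallel arcs
-- is automatic since arcs form a relation).
record Digraph (n : ℕ) : Set where
  field
    arc      : Fin n → Fin n → Bool
    loopless : ∀ v → arc v v ≡ false
open Digraph public

data Walk {n : ℕ} (D : Digraph n) : Fin n → Fin n → ℕ → Set where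
  here : ∀ {u} → Walk D u u zero
  step : ∀ {u w v k} → arc D u w ≡ true → Walk D w v k → Walk D u v (suc k)

StronglyConnected : ∀ {n} → Digraph n → Set
StronglyConnected {n} D = ∀ (u v : Fin n) → ∃ λ k → Walk D u v k

vertices : (n : ℕ) → List (Fin n)
vertices n = allFinL n

reach : ∀ {n} → Digraph n → ℕ → Fin n → Fin n → Bool
reach D zero    u v = does (u ≟ v)
reach {n} D (suc k) u v =
  reach D k u v ∨ any (λ w → reach D k u w ∧ arc D w v) (vertices n)

firstFrom : (ℕ → Bool) → ℕ → ℕ → ℕ
firstFrom p j zero       = j
firstFrom p j (suc fuel) = if p j then j else firstFrom p (suc j) fuel

-- shortest directed u–v path length (a shortest walk is a path, of length < n);
-- value n is a dummy for unreachable pairs (never used under strong connectivity).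
dist : ∀ {n} → Digraph n → Fin n → Fin n → ℕ
dist {n} D u v = firstFrom (λ k → reach D k u v) 0 n

md : ∀ {n} → Digraph n → Fin n → Fin n → ℕ
md D u v = dist D u v ⊔ dist D v u

mecc : ∀ {n} → Digraph n → Fin n → ℕ
mecc {n} D u = foldr _⊔_ 0 (map (md D u) (vertices n))

count : ∀ {n} → (Fin n → Bool) → ℕ
count {n} p = sum (map (λ v → if p v then 1 else 0) (vertices n))

outdeg indeg : ∀ {n} → Digraph n → Fin n → ℕ
outdeg D u = count (λ v → arc D u v)
indeg  D u = count (λ v → arc D v u)

-- twice the eccentric-type index:  2 ξ^C(D) = Σ_u (d⁺_u + d⁻_u) · mecc(u)
twiceXiC : ∀ {n} → Digraph n → ℕ
twiceXiC {n} D = sum (map (λ u → (outdeg D u + indeg D u) * mecc D u) (vertices n))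

-- D is (a labelling of) the complete biorientation of the star S_n:
-- some centre c such that the arcs are exactly (x,c),(c,x) for x ≠ c.
IsBiorientedStar : ∀ {n} → Digraph n → Set
IsBiorientedStar {n} D =
  Σ (Fin n) λ c → ∀ (u v : Fin n) →
    (arc D u v ≡ true) ⇔ ((¬ u ≡ v) × (u ≡ c ⊎ v ≡ c))

-- Write 2ξ^C(D) = Σ_u w(u) with w(u) = (d⁺_u + d⁻_u) · mecc(u).  Strong connectivity gives
-- d⁺_u, d⁻_u ≥ 1, and mecc(u) ≤ 1 exactly when u is joined to every other vertex in both
-- directions (u is universal), in which case w(u) ≥ 2(n−1); otherwise mecc(u) ≥ 2.  So w ≥ 4
-- everywhere.  If some vertex c is universal, Σ w ≥ 2(n−1) + 4(n−1), and equality forces every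
-- other vertex to have w = 4, hence a single out-arc, which must go to c: D is the bioriented
-- star.  If no vertex is universal, either w ≥ 6 everywhere, or some u has w(u) ≤ 5; then u has
-- a unique out-neighbour B and in-neighbour A and mecc(u) = 2, so every path of length two from
-- u passes through B and every one into u through A.  Hence B has an arc to, and A an arc from,
-- every vertex other than u and itself; A ≠ B both have w ≥ 2(n−1), and Σ w > 6(n−1).
module Submission where

open import Data.Bool using (Bool; true; false; if_then_else_; T; _∧_)
open import Data.Bool.ListAction using (any)
open import Data.Bool.Properties using (¬-not; T-∨; T-∧; T-≡)
open import Data.Fin using (Fin; _≟_; punchIn; punchOut) renaming (zero to fzero; suc to fsuc)
open import Data.Fin.Properties using (any?; toℕ<n; punchInᵢ≢i; punchIn-punchOut; punchIn-injective)
open import Data.List using ([]; _∷_; foldr; map; tabulate)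
open import Data.List.Membership.Propositional using (lose)
open import Data.List.Membership.Propositional.Properties using (∈-allFin)
open import Data.List.Properties using (map-tabulate)
open import Data.List.Relation.Unary.All using (All; []; _∷_)
import Data.List.Relation.Unary.All.Properties as All
open import Data.List.Relation.Unary.Any using (satisfied)
open import Data.List.Relation.Unary.Any.Properties using (any⁺; any⁻)
open import Data.Nat
  using (ℕ; zero; suc; _+_; _*_; _∸_; _⊔_; _≤_; _<_; _≤?_; _<?_; z≤n; s≤s; z<s; _≤′_; ≤′-refl; ≤′-step)
open import Data.Nat.ListAction using (sum)
open import Data.Nat.Properties hiding (_≟_)
open import Data.Nat.Tactic.RingSolver using (solve-∀)
open import Algebra.Properties.CommutativeMonoid.Sum +-0-commutativeMonoid
  using (sum-remove) renaming (sum to ∑)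
open import Data.Product as Product using (∃-syntax; _×_; _,_; proj₁; proj₂)
open import Data.Sum as Sum using (_⊎_; inj₁; inj₂)
open import Data.Unit using (tt)
open import Data.Vec.Functional using (removeAt)
open import Function using (_∘_; _∘₂_; id; case_of_)
open import Function.Bundles using (_⇔_; mk⇔; module Equivalence)
import Function.Properties.Equivalence as ⇔
open import Relation.Binary.PropositionalEquality
open import Relation.Nullary using (¬_; ¬?; _×-dec_; yes; no; does; contradiction)

open import Defs

sum-tabulate : ∀ {n} (f : Fin n → ℕ) → sum (tabulate f) ≡ ∑ f
sum-tabulate {zero}  f = refl
sum-tabulate {suc n} f = cong (f fzero +_) (sum-tabulate (f ∘ fsuc))

sum-map-vertices : ∀ {n} (f : Fin n → ℕ) → sum (map f (vertices n)) ≡ ∑ f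
sum-map-vertices f = trans (cong sum (map-tabulate id f)) (sum-tabulate f)

∑-≥-term : ∀ {n} (f : Fin n → ℕ) c → f c ≤ ∑ f
∑-≥-term f fzero    = m≤m+n (f fzero) _
∑-≥-term f (fsuc c) = ≤-trans (∑-≥-term (f ∘ fsuc) c) (m≤n+m _ (f fzero))

∑-≥-const : ∀ {n k} (f : Fin n → ℕ) → (∀ v → k ≤ f v) → n * k ≤ ∑ f
∑-≥-const {zero}  f k≤f = z≤n
∑-≥-const {suc n} f k≤f = +-mono-≤ (k≤f fzero) (∑-≥-const (f ∘ fsuc) (k≤f ∘ fsuc))

∑-≡-const : ∀ {n k} (f : Fin n → ℕ) → (∀ v → f v ≡ k) → ∑ f ≡ n * k
∑-≡-const {zero}  f f≡k = refl
∑-≡-const {suc n} f f≡k = cong₂ _+_ (f≡k fzero) (∑-≡-const (f ∘ fsuc) (f≡k ∘ fsuc))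

module _ {n k : ℕ} (f : Fin (suc n) → ℕ) (c : Fin (suc n)) where
  open ≤-Reasoning

  ∑-≥-allBut₁ : (∀ v → v ≢ c → k ≤ f v) → f c + n * k ≤ ∑ f
  ∑-≥-allBut₁ k≤f = begin
    f c + n * k            ≤⟨ +-monoʳ-≤ (f c) (∑-≥-const (removeAt f c) λ v → k≤f _ (punchInᵢ≢i c v)) ⟩
    f c + ∑ (removeAt f c) ≡⟨ sum-remove f ⟨
    ∑ f                    ∎

  ∑-≡-allBut₁ : (∀ v → v ≢ c → f v ≡ k) → ∑ f ≡ f c + n * k
  ∑-≡-allBut₁ f≡k =
    trans (sum-remove f) (cong (f c +_) (∑-≡-const (removeAt f c) λ v → f≡k _ (punchInᵢ≢i c v)))

∑-≥-allBut₂ : ∀ {n k} (f : Fin (suc (suc n)) → ℕ) {c d} → c ≢ d →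
  (∀ v → v ≢ c → v ≢ d → k ≤ f v) → f c + f d + n * k ≤ ∑ f
∑-≥-allBut₂ {n} {k} f {c} {d} c≢d k≤f = begin
  f c + f d + n * k                 ≡⟨ +-assoc (f c) (f d) (n * k) ⟩
  f c + (f d + n * k)               ≡⟨ cong (λ x → f c + (f x + n * k)) (punchIn-punchOut c≢d) ⟨
  f c + (g d′ + n * k)              ≤⟨ +-monoʳ-≤ (f c) (∑-≥-allBut₁ g d′ k≤g) ⟩
  f c + ∑ g                         ≡⟨ sum-remove f ⟨
  ∑ f                               ∎
  where
  open ≤-Reasoning
  g : Fin (suc n) → ℕ
  g = removeAt f c
  d′ : Fin (suc n)
  d′ = punchOut c≢d
  k≤g : ∀ v → v ≢ d′ → k ≤ g v
  k≤g v v≢d′ = k≤f _ (punchInᵢ≢i c v) λ eq →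
    v≢d′ (punchIn-injective c v d′ (trans eq (sym (punchIn-punchOut c≢d))))

indicator : Bool → ℕ
indicator b = if b then 1 else 0

module _ {n : ℕ} where

  count≡∑ : (p : Fin n → Bool) → count p ≡ ∑ (indicator ∘ p)
  count≡∑ p = sum-map-vertices (indicator ∘ p)

  1≤count : (p : Fin n → Bool) {w : Fin n} → p w ≡ true → 1 ≤ count p
  1≤count p {w} pw = subst₂ _≤_ (cong indicator pw) (sym (count≡∑ p)) (∑-≥-term (indicator ∘ p) w)

module _ {n : ℕ} (p : Fin (suc n) → Bool) (c : Fin (suc n)) where
  open ≤-Reasoning

  count-≥-allBut₁ : (∀ v → v ≢ c → p v ≡ true) → n ≤ count p
  count-≥-allBut₁ p≡true = begin
    n                        ≡⟨ *-identityʳ n ⟨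
    n * 1                    ≤⟨ m≤n+m (n * 1) _ ⟩
    indicator (p c) + n * 1  ≤⟨ ∑-≥-allBut₁ (indicator ∘ p) c
                                   (λ v v≢c → ≤-reflexive (cong indicator (sym (p≡true v v≢c)))) ⟩
    ∑ (indicator ∘ p)        ≡⟨ count≡∑ p ⟨
    count p                  ∎

  count-≡-singleton : p c ≡ true → (∀ v → v ≢ c → p v ≡ false) → count p ≡ 1
  count-≡-singleton pc p≡false = begin-equality
    count p                  ≡⟨ count≡∑ p ⟩
    ∑ (indicator ∘ p)        ≡⟨ ∑-≡-allBut₁ (indicator ∘ p) c (cong indicator ∘₂ p≡false) ⟩
    indicator (p c) + n * 0  ≡⟨ cong₂ _+_ (cong indicator pc) (*-zeroʳ n) ⟩
    1                        ∎

  count-≡-allBut₁ : p c ≡ false → (∀ v → v ≢ c → p v ≡ true) → count p ≡ n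
  count-≡-allBut₁ pc p≡true = begin-equality
    count p                  ≡⟨ count≡∑ p ⟩
    ∑ (indicator ∘ p)        ≡⟨ ∑-≡-allBut₁ (indicator ∘ p) c (cong indicator ∘₂ p≡true) ⟩
    indicator (p c) + n * 1  ≡⟨ cong₂ _+_ (cong indicator pc) (*-identityʳ n) ⟩
    n                        ∎

module _ {n : ℕ} (p : Fin (suc (suc n)) → Bool) where
  open ≤-Reasoning

  count-≥-allBut₂ : ∀ {c d} → c ≢ d → (∀ v → v ≢ c → v ≢ d → p v ≡ true) → n ≤ count p
  count-≥-allBut₂ {c} {d} c≢d p≡true = begin
    n                                          ≡⟨ *-identityʳ n ⟨
    n * 1                                      ≤⟨ m≤n+m (n * 1) _ ⟩
    indicator (p c) + indicator (p d) + n * 1  ≤⟨ ∑-≥-allBut₂ (indicator ∘ p) c≢d (λ v v≢c v≢d →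
                                                    ≤-reflexive (cong indicator (sym (p≡true v v≢c v≢d)))) ⟩
    ∑ (indicator ∘ p)                          ≡⟨ count≡∑ p ⟨
    count p                                    ∎

  count≤1⇒unique : count p ≤ 1 → ∀ {c d} → p c ≡ true → p d ≡ true → c ≡ d
  count≤1⇒unique count≤1 {c} {d} pc pd with c ≟ d
  ... | yes c≡d = c≡d
  ... | no c≢d  = contradiction count≤1 (<⇒≱ (begin-strict
    1                                          <⟨ s≤s (s≤s z≤n) ⟩
    2                                          ≡⟨ cong₂ (λ a b → indicator a + indicator b) pc pd ⟨
    indicator (p c) + indicator (p d)          ≤⟨ m≤m+n _ (n * 0) ⟩
    indicator (p c) + indicator (p d) + n * 0  ≤⟨ ∑-≥-allBut₂ (indicator ∘ p) c≢d (λ _ _ _ → z≤n) ⟩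
    ∑ (indicator ∘ p)                          ≡⟨ count≡∑ p ⟨
    count p                                    ∎))

Arc : ∀ {n} → Digraph n → Fin n → Fin n → Set
Arc D u v = arc D u v ≡ true

Within₂ : ∀ {n} → Digraph n → Fin n → Fin n → Set
Within₂ D u v = Arc D u v ⊎ ∃[ w ] Arc D u w × Arc D w v

Universal : ∀ {n} → Digraph n → Fin n → Set
Universal D u = ∀ v → v ≢ u → Arc D u v × Arc D v u

arc⇒≢ : ∀ {n} (D : Digraph n) {u v} → Arc D u v → u ≢ v
arc⇒≢ D {u} a refl with () ← trans (sym (loopless D u)) a

foldr-⊔-≤ : ∀ {k} xs → foldr _⊔_ 0 xs ≤ k ⇔ All (_≤ k) xs
foldr-⊔-≤ xs = mk⇔ (to xs) from
  where
  to : ∀ {k} xs → foldr _⊔_ 0 xs ≤ k → All (_≤ k) xs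
  to []       _ = []
  to (x ∷ xs) h = m⊔n≤o⇒m≤o x _ h ∷ to xs (m⊔n≤o⇒n≤o x _ h)
  from : ∀ {k xs} → All (_≤ k) xs → foldr _⊔_ 0 xs ≤ k
  from []         = z≤n
  from (x≤k ∷ h) = ⊔-lub x≤k (from h)

firstFrom-sound : ∀ p j fuel → T (p (firstFrom p j fuel)) ⊎ firstFrom p j fuel ≡ j + fuel
firstFrom-sound p j zero = inj₂ (sym (+-identityʳ j))
firstFrom-sound p j (suc fuel) with p j in pj
... | true  = inj₁ (subst T (sym pj) tt)
... | false = Sum.map₂ (λ eq → trans eq (sym (+-suc j fuel))) (firstFrom-sound p (suc j) fuel)

firstFrom-minimal : ∀ p j fuel {i} → T (p i) → j ≤ i → i < j + fuel → firstFrom p j fuel ≤ i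
firstFrom-minimal p j zero {i} _ j≤i i<j = contradiction (subst (i <_) (+-identityʳ j) i<j) (≤⇒≯ j≤i)
firstFrom-minimal p j (suc fuel) {i} pi j≤i i<j+fuel with p j in pj
... | true = j≤i
... | false with m≤n⇒m<n∨m≡n j≤i
...   | inj₁ j<i  = firstFrom-minimal p (suc j) fuel pi j<i (subst (i <_) (+-suc j fuel) i<j+fuel)
...   | inj₂ refl with () ← subst T pj pi

both-ways-off-diagonal : ∀ {n} {R Q : Fin n → Fin n → Set} {u} →
  (∀ {x y} → R x y ⇔ (x ≡ y ⊎ Q x y)) →
  (∀ v → R u v × R v u) ⇔ (∀ v → v ≢ u → Q u v × Q v u)
both-ways-off-diagonal {R = R} {Q} {u} R⇔ = mk⇔ to from
  where
  split : ∀ {x y} → R x y → x ≡ y ⊎ Q x y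
  split = Equivalence.to R⇔
  join : ∀ {x y} → x ≡ y ⊎ Q x y → R x y
  join = Equivalence.from R⇔
  off : ∀ {x y} → R x y → x ≢ y → Q x y
  off r x≢y with split r
  ... | inj₁ x≡y = contradiction x≡y x≢y
  ... | inj₂ q   = q
  to : (∀ v → R u v × R v u) → ∀ v → v ≢ u → Q u v × Q v u
  to h v v≢u = off (proj₁ (h v)) (v≢u ∘ sym) , off (proj₂ (h v)) v≢u
  from : (∀ v → v ≢ u → Q u v × Q v u) → ∀ v → R u v × R v u
  from h v with v ≟ u
  ... | yes refl = join (inj₁ refl) , join (inj₁ refl)
  ... | no v≢u   = join (inj₂ (proj₁ (h v v≢u))) , join (inj₂ (proj₂ (h v v≢u)))

module Distances {n : ℕ} (D : Digraph n) where
  open Equivalence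

  -- A record rather than T (reach D k u v), so that k, u and v can be inferred from a proof.
  record Reach (k : ℕ) (u v : Fin n) : Set where
    constructor reached
    field reached? : T (reach D k u v)
  open Reach

  reach-zero : ∀ {u v} → Reach 0 u v ⇔ u ≡ v
  reach-zero {u} {v} = mk⇔ (to T-does ∘ reached?) (reached ∘ from T-does)
    where
    T-does : T (does (u ≟ v)) ⇔ u ≡ v
    T-does with u ≟ v
    ... | yes u≡v = mk⇔ (λ _ → u≡v) (λ _ → tt)
    ... | no u≢v  = mk⇔ (λ ()) u≢v

  reach-suc : ∀ {k u v} → Reach (suc k) u v ⇔ (Reach k u v ⊎ ∃[ w ] Reach k u w × Arc D w v)
  reach-suc {k} {u} {v} = mk⇔ split join
    where
    last-step : Fin n → Bool
    last-step w = reach D k u w ∧ arc D w v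
    split : Reach (suc k) u v → Reach k u v ⊎ ∃[ w ] Reach k u w × Arc D w v
    split (reached r) with to T-∨ r
    ... | inj₁ r′ = inj₁ (reached r′)
    ... | inj₂ r′ with w , rw ← satisfied (any⁻ last-step (vertices n) r′) =
      inj₂ (w , Product.map reached (to T-≡) (to T-∧ rw))
    join : Reach k u v ⊎ ∃[ w ] Reach k u w × Arc D w v → Reach (suc k) u v
    join (inj₁ (reached r)) = reached (from T-∨ (inj₁ r))
    join (inj₂ (w , reached r , a)) =
      reached (from T-∨ (inj₂ (any⁺ last-step (lose (∈-allFin w) (from T-∧ (r , from T-≡ a))))))

  reach-step : ∀ {k u v} → Reach k u v → Reach (suc k) u v
  reach-step r = from reach-suc (inj₁ r)

  reach-mono : ∀ {j k u v} → j ≤ k → Reach j u v → Reach k u v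
  reach-mono j≤k = go (≤⇒≤′ j≤k)
    where
    go : ∀ {j k u v} → j ≤′ k → Reach j u v → Reach k u v
    go ≤′-refl        r = r
    go (≤′-step j≤′k) r = reach-step (go j≤′k r)

  reach-refl : ∀ k u → Reach k u u
  reach-refl k u = reach-mono z≤n (from reach-zero refl)

  reach-one : ∀ {u v} → Reach 1 u v ⇔ (u ≡ v ⊎ Arc D u v)
  reach-one {u} {v} = mk⇔ split join
    where
    split : Reach 1 u v → u ≡ v ⊎ Arc D u v
    split r with to reach-suc r
    ... | inj₁ r₀ = inj₁ (to reach-zero r₀)
    ... | inj₂ (w , r₀ , a) with refl ← to reach-zero r₀ = inj₂ a
    join : u ≡ v ⊎ Arc D u v → Reach 1 u v
    join (inj₁ refl) = reach-refl 1 u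
    join (inj₂ a)    = from reach-suc (inj₂ (u , reach-refl 0 u , a))

  reach-two : ∀ {u v} → Reach 2 u v ⇔ (u ≡ v ⊎ Within₂ D u v)
  reach-two {u} {v} = mk⇔ split join
    where
    split : Reach 2 u v → u ≡ v ⊎ Within₂ D u v
    split r with to reach-suc r
    ... | inj₁ r₁ = Sum.map₂ inj₁ (to reach-one r₁)
    ... | inj₂ (w , r₁ , b) with to reach-one r₁
    ...   | inj₁ refl = inj₂ (inj₁ b)
    ...   | inj₂ a    = inj₂ (inj₂ (w , a , b))
    join : u ≡ v ⊎ Within₂ D u v → Reach 2 u v
    join (inj₁ u≡v)                 = reach-step (from reach-one (inj₁ u≡v))
    join (inj₂ (inj₁ a))            = reach-step (from reach-one (inj₂ a))
    join (inj₂ (inj₂ (w , a , b))) = from reach-suc (inj₂ (w , from reach-one (inj₂ a) , b))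

  dist≤⇔reach : ∀ {k u v} → k < n → dist D u v ≤ k ⇔ Reach k u v
  dist≤⇔reach {k} {u} {v} k<n = mk⇔ split (λ r → firstFrom-minimal _ 0 n (reached? r) z≤n k<n)
    where
    split : dist D u v ≤ k → Reach k u v
    split d≤k with firstFrom-sound (λ i → reach D i u v) 0 n
    ... | inj₁ r   = reach-mono d≤k (reached r)
    ... | inj₂ d≡n = contradiction (subst (_≤ k) d≡n d≤k) (<⇒≱ k<n)

  mecc≤⇔dist≤ : ∀ {k u} → mecc D u ≤ k ⇔ (∀ v → dist D u v ≤ k × dist D v u ≤ k)
  mecc≤⇔dist≤ {k} {u} = mk⇔ split join
    where
    split : mecc D u ≤ k → ∀ v → dist D u v ≤ k × dist D v u ≤ k
    split h v = m⊔n≤o⇒m≤o _ _ md≤k , m⊔n≤o⇒n≤o _ _ md≤k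
      where md≤k = All.tabulate⁻ (All.map⁻ (to (foldr-⊔-≤ _) h)) v
    join : (∀ v → dist D u v ≤ k × dist D v u ≤ k) → mecc D u ≤ k
    join h = from (foldr-⊔-≤ _) (All.map⁺ (All.tabulate⁺ λ v → ⊔-lub (proj₁ (h v)) (proj₂ (h v))))

  mecc≤⇔reach : ∀ {k u} → k < n → mecc D u ≤ k ⇔ (∀ v → Reach k u v × Reach k v u)
  mecc≤⇔reach k<n = mk⇔
    (λ h v → Product.map (to (dist≤⇔reach k<n)) (to (dist≤⇔reach k<n)) (to mecc≤⇔dist≤ h v))
    (λ h → from mecc≤⇔dist≤ λ v → Product.map (from (dist≤⇔reach k<n)) (from (dist≤⇔reach k<n)) (h v))

  mecc≤1⇔universal : ∀ {u} → 1 < n → mecc D u ≤ 1 ⇔ Universal D u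
  mecc≤1⇔universal 1<n = ⇔.trans (mecc≤⇔reach 1<n) (both-ways-off-diagonal reach-one)

  mecc≤2⇔within₂ : ∀ {u} → 2 < n → mecc D u ≤ 2 ⇔ (∀ v → v ≢ u → Within₂ D u v × Within₂ D v u)
  mecc≤2⇔within₂ 2<n = ⇔.trans (mecc≤⇔reach 2<n) (both-ways-off-diagonal reach-two)

  1≤mecc : ∀ {u v} → v ≢ u → 1 ≤ mecc D u
  1≤mecc {u} {v} v≢u = ≰⇒> λ mecc≤0 →
    v≢u (sym (to reach-zero (proj₁ (to (mecc≤⇔reach (≤-trans (s≤s z≤n) (toℕ<n u))) mecc≤0 v))))

module _ {n : ℕ} {D : Digraph n} where

  first-arc : ∀ {u v k} → Walk D u v k → u ≢ v → ∃[ w ] Arc D u w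
  first-arc here       u≢u = contradiction refl u≢u
  first-arc (step a _) _   = _ , a

  last-arc : ∀ {u v k} → Walk D u v k → u ≢ v → ∃[ w ] Arc D w v
  last-arc here                  u≢u = contradiction refl u≢u
  last-arc {v = v} (step {u} {w} a p) u≢v with w ≟ v
  ... | yes refl = u , a
  ... | no w≢v   = last-arc p w≢v

m*n<6⇒m≤2 : ∀ {m n} → 2 ≤ n → m * n < 6 → m ≤ 2
m*n<6⇒m≤2 2≤n m*n<6 = ≮⇒≥ λ 2<m → <-irrefl refl (<-≤-trans m*n<6 (*-mono-≤ 2<m 2≤n))

m+n≤2⇒m≤1 : ∀ {m n} → 1 ≤ n → m + n ≤ 2 → m ≤ 1
m+n≤2⇒m≤1 {m} 1≤n m+n≤2 = +-cancelʳ-≤ 1 m 1 (≤-trans (+-monoʳ-≤ m 1≤n) m+n≤2)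

<-by-gap : ∀ {x y} z → y ≡ suc x + z → x < y
<-by-gap {x} z y≡ = ≤-trans (m≤m+n (suc x) z) (≤-reflexive (sym y≡))

two-heavy-excess : ∀ m → 6 * (3 + m) < (3 + m + (3 + m)) + (3 + m + (3 + m)) + (2 + m) * 4
two-heavy-excess m = <-by-gap (1 + 2 * m) (identity m)
  where
  identity : ∀ m → (3 + m + (3 + m)) + (3 + m + (3 + m)) + (2 + m) * 4 ≡ suc (6 * (3 + m)) + (1 + 2 * m)
  identity = solve-∀

heavy-and-five-excess : ∀ m → 6 * (3 + m) < (3 + m + (3 + m)) + 5 + (2 + m) * 4
heavy-and-five-excess m = <-by-gap 0 (identity m)
  where
  identity : ∀ m → (3 + m + (3 + m)) + 5 + (2 + m) * 4 ≡ suc (6 * (3 + m)) + 0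
  identity = solve-∀

six-everywhere-excess : ∀ n → 6 * n < suc n * 6
six-everywhere-excess n = subst (_< suc n * 6) (*-comm n 6) (m<n+m (n * 6) z<s)

double : ∀ n → n + n ≡ n * 2
double = solve-∀

star-identity : ∀ n → (n + n) * 1 + n * 4 ≡ 6 * n
star-identity = solve-∀

module OrderAtLeast4 (m : ℕ) (D : Digraph (4 + m)) (strong : StronglyConnected D) where
  open Distances D
  open Equivalence

  -- D has suc n vertices, so the paper's n − 1 is n here.
  n : ℕ
  n = 3 + m

  deg : Fin (suc n) → ℕ
  deg u = outdeg D u + indeg D u

  weight : Fin (suc n) → ℕ
  weight u = deg u * mecc D u

  Heavy : Fin (suc n) → Set
  Heavy u = n + n ≤ weight u

  twiceXiC≡∑weight : twiceXiC D ≡ ∑ weight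
  twiceXiC≡∑weight = sum-map-vertices weight

  1<order : 1 < suc n
  1<order = s≤s (s≤s z≤n)

  2<order : 2 < suc n
  2<order = s≤s (s≤s (s≤s z≤n))

  6≤n+n : 6 ≤ n + n
  6≤n+n = +-mono-≤ (m≤m+n 3 m) (m≤m+n 3 m)

  other-vertex : (u : Fin (suc n)) → ∃[ v ] v ≢ u
  other-vertex u = punchIn u fzero , punchInᵢ≢i u fzero

  out-neighbour : ∀ u → ∃[ w ] Arc D u w
  out-neighbour u with v , v≢u ← other-vertex u = first-arc (proj₂ (strong u v)) (v≢u ∘ sym)

  in-neighbour : ∀ u → ∃[ w ] Arc D w u
  in-neighbour u with v , v≢u ← other-vertex u = last-arc (proj₂ (strong v u)) v≢u

  1≤outdeg : ∀ u → 1 ≤ outdeg D u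
  1≤outdeg u = 1≤count (arc D u) (proj₂ (out-neighbour u))

  1≤indeg : ∀ u → 1 ≤ indeg D u
  1≤indeg u = 1≤count (λ v → arc D v u) (proj₂ (in-neighbour u))

  ¬universal⇒2≤mecc : ∀ {u} → ¬ Universal D u → 2 ≤ mecc D u
  ¬universal⇒2≤mecc ¬univ = ≰⇒> (¬univ ∘ to (mecc≤1⇔universal 1<order))

  deg-mecc⇒heavy : ∀ u → n ≤ deg u → 2 ≤ mecc D u → Heavy u
  deg-mecc⇒heavy _ n≤deg 2≤mecc = ≤-trans (≤-reflexive (double n)) (*-mono-≤ n≤deg 2≤mecc)

  universal⇒heavy : ∀ {u} → Universal D u → Heavy u
  universal⇒heavy {u} univ = ≤-trans (≤-reflexive (sym (*-identityʳ (n + n))))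
    (*-mono-≤ (+-mono-≤ (count-≥-allBut₁ (arc D u) u (λ v v≢u → proj₁ (univ v v≢u)))
                        (count-≥-allBut₁ (λ v → arc D v u) u (λ v v≢u → proj₂ (univ v v≢u))))
              (1≤mecc (proj₂ (other-vertex u))))

  4≤weight : ∀ u → 4 ≤ weight u
  4≤weight u = case mecc D u ≤? 1 of λ where
    (yes mecc≤1) → ≤-trans (m≤m+n 4 2)
                     (≤-trans 6≤n+n (universal⇒heavy (to (mecc≤1⇔universal 1<order) mecc≤1)))
    (no  mecc≰1) → *-mono-≤ (+-mono-≤ (1≤outdeg u) (1≤indeg u)) (≰⇒> mecc≰1)

  two-heavy⇒strict : ∀ {c d} → c ≢ d → Heavy c → Heavy d → 6 * n < ∑ weight
  two-heavy⇒strict c≢d heavy-c heavy-d = <-≤-trans (two-heavy-excess m)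
    (≤-trans (+-monoˡ-≤ _ (+-mono-≤ heavy-c heavy-d))
             (∑-≥-allBut₂ weight c≢d (λ v _ _ → 4≤weight v)))

  module _ {u} (light : weight u < 6) where

    light⇒¬universal : ¬ Universal D u
    light⇒¬universal univ = <-irrefl refl (<-≤-trans light (≤-trans 6≤n+n (universal⇒heavy univ)))

    light⇒deg≤2 : deg u ≤ 2
    light⇒deg≤2 = m*n<6⇒m≤2 {deg u} (¬universal⇒2≤mecc {u} light⇒¬universal) light

    light⇒out-unique : ∀ {x y} → Arc D u x → Arc D u y → x ≡ y
    light⇒out-unique = count≤1⇒unique (arc D u) (m+n≤2⇒m≤1 (1≤indeg u) light⇒deg≤2)

    light⇒in-unique : ∀ {x y} → Arc D x u → Arc D y u → x ≡ y
    light⇒in-unique = count≤1⇒unique (λ v → arc D v u)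
      (m+n≤2⇒m≤1 (1≤outdeg u) (≤-trans (≤-reflexive (+-comm (indeg D u) _)) light⇒deg≤2))

  module Acentric (acentric : ∀ u → ¬ Universal D u) {u} (light : weight u < 6) where

    mecc≤2 : mecc D u ≤ 2
    mecc≤2 = m*n<6⇒m≤2 {mecc D u} {deg u} (+-mono-≤ (1≤outdeg u) (1≤indeg u))
      (subst (_< 6) (*-comm (deg u) (mecc D u)) light)

    B A : Fin (suc n)
    B = proj₁ (out-neighbour u)
    A = proj₁ (in-neighbour u)

    u→B : Arc D u B
    u→B = proj₂ (out-neighbour u)

    A→u : Arc D A u
    A→u = proj₂ (in-neighbour u)

    within₂ : ∀ v → v ≢ u → Within₂ D u v × Within₂ D v u
    within₂ = to (mecc≤2⇔within₂ 2<order) mecc≤2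

    B-dominates : ∀ v → v ≢ u → v ≢ B → Arc D B v
    B-dominates v v≢u v≢B = case proj₁ (within₂ v v≢u) of λ where
      (inj₁ u→v)             → contradiction (light⇒out-unique light u→v u→B) v≢B
      (inj₂ (w , u→w , w→v)) → subst (λ x → Arc D x v) (light⇒out-unique light u→w u→B) w→v

    A-absorbs : ∀ v → v ≢ u → v ≢ A → Arc D v A
    A-absorbs v v≢u v≢A = case proj₂ (within₂ v v≢u) of λ where
      (inj₁ v→u)             → contradiction (light⇒in-unique light v→u A→u) v≢A
      (inj₂ (w , v→w , w→u)) → subst (Arc D v) (light⇒in-unique light w→u A→u) v→w

    heavy-B : Heavy B
    heavy-B = deg-mecc⇒heavy B
      (≤-trans (≤-reflexive (+-comm 1 (2 + m)))
        (+-mono-≤ (count-≥-allBut₂ (arc D B) (arc⇒≢ D u→B) B-dominates)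
                  (1≤count (λ v → arc D v B) u→B)))
      (¬universal⇒2≤mecc {B} (acentric B))

    heavy-A : Heavy A
    heavy-A = deg-mecc⇒heavy A
      (+-mono-≤ (1≤count (arc D A) A→u)
                (count-≥-allBut₂ (λ v → arc D v A) (arc⇒≢ D A→u ∘ sym) A-absorbs))
      (¬universal⇒2≤mecc {A} (acentric A))

    A≢B : A ≢ B
    A≢B A≡B = acentric A universal-A
      where
      universal-A : Universal D A
      universal-A v v≢A = case v ≟ u of λ where
        (yes refl) → A→u , subst (Arc D u) (sym A≡B) u→B
        (no  v≢u)  → subst (λ x → Arc D x v) (sym A≡B)
                         (B-dominates v v≢u λ v≡B → v≢A (trans v≡B (sym A≡B)))
                     , A-absorbs v v≢u v≢A

    strict : 6 * n < ∑ weight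
    strict = two-heavy⇒strict A≢B heavy-A heavy-B

  acentric⇒strict : (∀ u → ¬ Universal D u) → 6 * n < ∑ weight
  acentric⇒strict acentric = case any? (λ u → weight u <? 6) of λ where
    (yes (u , light)) → Acentric.strict acentric light
    (no  no-light)    → <-≤-trans (six-everywhere-excess n)
                            (∑-≥-const weight λ v → ≮⇒≥ λ light → no-light (v , light))

  light-leaves⇒star : ∀ {c} → Universal D c → (∀ v → v ≢ c → weight v < 5) → IsBiorientedStar D
  light-leaves⇒star {c} centre light = c , λ u v → mk⇔ (arc-shape u v) (star-arc u v)
    where
    arc-shape : ∀ u v → Arc D u v → u ≢ v × (u ≡ c ⊎ v ≡ c)
    arc-shape u v u→v = arc⇒≢ D u→v , touches-centre
      where
      touches-centre : u ≡ c ⊎ v ≡ c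
      touches-centre = case u ≟ c of λ where
        (yes u≡c) → inj₁ u≡c
        (no  u≢c) → inj₂ (light⇒out-unique (m<n⇒m<1+n (light u u≢c)) u→v (proj₂ (centre u u≢c)))
    star-arc : ∀ u v → u ≢ v × (u ≡ c ⊎ v ≡ c) → Arc D u v
    star-arc u v (u≢v , inj₁ refl) = proj₁ (centre v (u≢v ∘ sym))
    star-arc u v (u≢v , inj₂ refl) = proj₂ (centre u u≢v)

  centre⇒strict-or-star : ∀ {c} → Universal D c → 6 * n < ∑ weight ⊎ IsBiorientedStar D
  centre⇒strict-or-star {c} centre = case any? (λ v → ¬? (v ≟ c) ×-dec (5 ≤? weight v)) of λ where
    (yes (v , v≢c , 5≤weight)) → inj₁ (<-≤-trans (heavy-and-five-excess m)
          (≤-trans (+-monoˡ-≤ _ (+-mono-≤ (universal⇒heavy centre) 5≤weight))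
                   (∑-≥-allBut₂ weight (v≢c ∘ sym) (λ w _ _ → 4≤weight w))))
    (no  no-heavy-leaf) → inj₂ (light-leaves⇒star centre λ v v≢c →
                              ≰⇒> λ 5≤weight → no-heavy-leaf (v , v≢c , 5≤weight))

  strict-or-star : 6 * n < ∑ weight ⊎ IsBiorientedStar D
  strict-or-star = case any? (λ c → mecc D c ≤? 1) of λ where
    (yes (c , mecc≤1)) → centre⇒strict-or-star (to (mecc≤1⇔universal {c} 1<order) mecc≤1)
    (no  no-centre)    → inj₁ (acentric⇒strict λ u univ →
                                 no-centre (u , from (mecc≤1⇔universal 1<order) univ))

  star⇒∑weight≡ : IsBiorientedStar D → ∑ weight ≡ 6 * n
  star⇒∑weight≡ (c , star) = begin
    ∑ weight              ≡⟨ ∑-≡-allBut₁ weight c weight-leaf ⟩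
    weight c + n * 4      ≡⟨ cong (_+ n * 4) weight-centre ⟩
    (n + n) * 1 + n * 4   ≡⟨ star-identity n ⟩
    6 * n                 ∎
    where
    open ≡-Reasoning
    centre : Universal D c
    centre v v≢c = from (star c v) ((v≢c ∘ sym) , inj₁ refl) , from (star v c) (v≢c , inj₂ refl)

    leaf↛leaf : ∀ {v w} → v ≢ c → w ≢ c → arc D v w ≡ false
    leaf↛leaf v≢c w≢c = ¬-not λ v→w → Sum.[ v≢c , w≢c ] (proj₂ (to (star _ _) v→w))

    outdeg-centre : outdeg D c ≡ n
    outdeg-centre = count-≡-allBut₁ (arc D c) c (loopless D c) (λ v v≢c → proj₁ (centre v v≢c))

    indeg-centre : indeg D c ≡ n
    indeg-centre = count-≡-allBut₁ (λ v → arc D v c) c (loopless D c) (λ v v≢c → proj₂ (centre v v≢c))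

    mecc-centre : mecc D c ≡ 1
    mecc-centre = ≤-antisym (from (mecc≤1⇔universal 1<order) centre) (1≤mecc (proj₂ (other-vertex c)))

    weight-centre : weight c ≡ (n + n) * 1
    weight-centre = cong₂ _*_ (cong₂ _+_ outdeg-centre indeg-centre) mecc-centre

    module Leaf {v} (v≢c : v ≢ c) where
      outdeg≡1 : outdeg D v ≡ 1
      outdeg≡1 = count-≡-singleton (arc D v) c (proj₂ (centre v v≢c)) (λ w w≢c → leaf↛leaf v≢c w≢c)

      indeg≡1 : indeg D v ≡ 1
      indeg≡1 = count-≡-singleton (λ w → arc D w v) c (proj₁ (centre v v≢c))
                                  (λ w w≢c → leaf↛leaf w≢c v≢c)

      ¬universal : ¬ Universal D v
      ¬universal univ with s≤s () ← ≤-trans (count-≥-allBut₁ (arc D v) v (λ w w≢v → proj₁ (univ w w≢v)))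
                                            (≤-reflexive outdeg≡1)

      via-centre : ∀ w → w ≢ v → Within₂ D v w × Within₂ D w v
      via-centre w w≢v = case w ≟ c of λ where
        (yes refl) → inj₁ (proj₂ (centre v v≢c)) , inj₁ (proj₁ (centre v v≢c))
        (no  w≢c)  → inj₂ (c , proj₂ (centre v v≢c) , proj₁ (centre w w≢c))
                     , inj₂ (c , proj₂ (centre w w≢c) , proj₁ (centre v v≢c))

      mecc≡2 : mecc D v ≡ 2
      mecc≡2 = ≤-antisym (from (mecc≤2⇔within₂ 2<order) via-centre) (¬universal⇒2≤mecc {v} ¬universal)

    weight-leaf : ∀ v → v ≢ c → weight v ≡ 4
    weight-leaf v v≢c = cong₂ _*_ (cong₂ _+_ outdeg≡1 indeg≡1) mecc≡2
      where open Leaf v≢c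

  ∑weight-bound : 6 * n ≤ ∑ weight × (∑ weight ≡ 6 * n ⇔ IsBiorientedStar D)
  ∑weight-bound = case strict-or-star of λ where
    (inj₁ 6n<∑) → <⇒≤ 6n<∑ , mk⇔ (λ ∑≡6n → contradiction ∑≡6n (>⇒≢ 6n<∑)) star⇒∑weight≡
    (inj₂ star) → ≤-reflexive (sym (star⇒∑weight≡ star)) , mk⇔ (λ _ → star) star⇒∑weight≡

theorem7 : (n : ℕ) → 4 ≤ n → (D : Digraph n) → StronglyConnected D →
    (6 * (n ∸ 1) ≤ twiceXiC D) × ((twiceXiC D ≡ 6 * (n ∸ 1)) ⇔ IsBiorientedStar D)
theorem7 (suc (suc (suc (suc m)))) _ D strong =
  subst (λ x → 6 * n ≤ x × (x ≡ 6 * n ⇔ IsBiorientedStar D)) (sym twiceXiC≡∑weight) ∑weight-bound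
  where open OrderAtLeast4 m D strong
theorem7 zero                   ()                   _ _
theorem7 (suc zero)             (s≤s ())             _ _
theorem7 (suc (suc zero))       (s≤s (s≤s ()))       _ _
theorem7 (suc (suc (suc zero))) (s≤s (s≤s (s≤s ()))) _ _
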